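{- Let $1\le k<n$ and let $\alpha_1,\dots,\alpha_{k-1}$ be positive reals such that each ratio $\alpha_{i+1}/\alpha_i$ is sufficiently small (depending on $k,n$). For $I=(i_1,\dots,i_k)\in V_{k,n}$ set $w(I)=\sum_{1\le a<b\le k}\alpha_{b-a}i_ai_b$. Let $\{I,J\}$ and $\{X,Y\}$ be two different pairs of elements of $V_{k,n}$ such that $I$ and $J$ are noncrossing and $\chi_I+\chi_J=\chi_X+\chi_Y$. Then $X$ and $Y$ are crossing, and $w(I)+w(J)<w(X)+w(Y)$.
   Context: $V_{k,n}$ is the set of strictly increasing vectors $(i_1,\dots,i_k)$ with entries in $[n]$. For $I\in V_{k,n}$, $\chi_I\in\{0,1\}^{[k]\times[n-k]}$ has $(\chi_I)_{a,b}=1$ iff $i_a\le a+b-1$. Arcs $(p<p')$, $(q<q')$ cross if $p<q<p'<q'$ or $q<p<q'<p'$. $I,J\in V_{k,n}$ are noncrossing if for all $1\le a<b\le k$ with $i_\ell=j_\ell$ for all $a<\ell<b$, the arcs $(i_a<i_b)$ and $(j_a<j_b)$ do not cross; otherwise they are crossing.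
   Formalization: The weights $\alpha_1,\dots,\alpha_{k-1}$ are positive rationals rather than positive reals. -}

module Defs where

open import Data.Nat as ℕ using (ℕ; zero; suc; _∸_; _≤ᵇ_; _<ᵇ_)
import Data.Fin
open Data.Fin using (Fin; toℕ)
open import Data.Vec using (Vec; lookup)
open import Data.Bool using (if_then_else_)
open import Data.Product using (_×_)
open import Data.Sum using (_⊎_)
open import Data.Integer using (+_)
open import Data.Rational as ℚ using (ℚ; 0ℚ; _/_)
open import Relation.Nullary using (¬_)
open import Relation.Binary.PropositionalEquality using (_≡_)

-- V_{k,n}: strictly increasing vectors (i_1,…,i_k) with entries in [n] = {1,…,n}.
-- Positions are 0-indexed (Fin k), values are the actual entries in ℕ.
InV : (k n : ℕ) → Vec ℕ k → Set
InV k n I =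
  (∀ (a : Fin k) → 1 ℕ.≤ lookup I a × lookup I a ℕ.≤ n) ×
  (∀ (a b : Fin k) → toℕ a ℕ.< toℕ b → lookup I a ℕ.< lookup I b)

-- χ_I ∈ {0,1}^{[k]×[n-k]}: (χ_I)_{a,b} = 1 iff i_a ≤ a+b-1 (1-indexed a,b).
-- With 0-indexed a' = a-1, b' = b-1 this is i_a ≤ a'+b'+1.
χ : {k : ℕ} (n : ℕ) → Vec ℕ k → Fin k → Fin (n ∸ k) → ℕ
χ n I a b = if lookup I a ≤ᵇ suc (toℕ a ℕ.+ toℕ b) then 1 else 0

ArcsCross : ℕ → ℕ → ℕ → ℕ → Set
ArcsCross p p' q q' =
  (p ℕ.< q × q ℕ.< p' × p' ℕ.< q') ⊎ (q ℕ.< p × p ℕ.< q' × q' ℕ.< p')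

Noncrossing : {k : ℕ} → Vec ℕ k → Vec ℕ k → Set
Noncrossing {k} I J =
  ∀ (a b : Fin k) → toℕ a ℕ.< toℕ b →
  (∀ (l : Fin k) → toℕ a ℕ.< toℕ l → toℕ l ℕ.< toℕ b → lookup I l ≡ lookup J l) →
  ¬ ArcsCross (lookup I a) (lookup I b) (lookup J a) (lookup J b)

Crossing : {k : ℕ} → Vec ℕ k → Vec ℕ k → Set
Crossing I J = ¬ Noncrossing I J

toℚ : ℕ → ℚ
toℚ m = (+ m) / 1

sumFin : (n : ℕ) → (Fin n → ℚ) → ℚ
sumFin zero f = 0ℚ
sumFin (suc n) f = f Data.Fin.zero ℚ.+ sumFin n (λ i → f (Data.Fin.suc i))

-- w(I) = Σ_{1≤a<b≤k} α_{b-a} i_a i_b ; α is indexed by 1,…,k-1 (other values unused).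
w : {k : ℕ} → (ℕ → ℚ) → Vec ℕ k → ℚ
w {k} α I = sumFin k λ a → sumFin k λ b →
  if toℕ a <ᵇ toℕ b
  then α (toℕ b ∸ toℕ a) ℚ.* toℚ (lookup I a) ℚ.* toℚ (lookup I b)
  else 0ℚ

{-# OPTIONS --safe #-}
module Submission where

-- Row a of χ_I samples t ↦ [i_a ≤ t] at t = a, …, a+n−k−1, and a ≤ i_a ≤ a+n−k, so the samples
-- determine the whole function: χ_I + χ_J = χ_X + χ_Y says exactly that {x_a, y_a} = {i_a, j_a} for
-- every column a.  As {X, Y} ≠ {I, J}, some column with i_a ≠ j_a is kept (x_a = i_a) and another
-- one is swapped.  Take such a kept/swapped pair of columns a < b with d = b − a minimal: all
-- columns strictly between are tied, so noncrossingness of I, J at (a, b) forces the arcs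
-- (i_a, i_b) and (j_a, j_b) to be nested.  Hence the rewired arcs of X, Y cross at (a, b), and
-- x_a x_b + y_a y_b > i_a i_b + j_a j_b by the rearrangement inequality.  In
-- w(X) + w(Y) − w(I) − w(J) the pairs at distance at most d contribute at least α_d in total,
-- while each of the at most k² pairs at distance more than d contributes at least −ε α_d K with
-- K = 2n²; so ε = 1/(1 + k² K) makes the difference positive.

open import Defs
open import Data.Nat as ℕ using (ℕ; suc; _∸_)
open import Data.Fin using (Fin)
open import Data.Vec using (Vec)
open import Data.Product using (_×_; ∃)
open import Data.Sum using (_⊎_)
open import Data.Rational as ℚ using (ℚ; 0ℚ)
open import Relation.Nullary using (¬_)
open import Relation.Binary.PropositionalEquality using (_≡_)
import Data.Nat.Properties as ℕ
open import Data.Product using (_,_; proj₂)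
open import Relation.Binary.PropositionalEquality using (sym; subst₂)

module Combinatorics where
  open import Data.Nat
  open import Data.Nat.Properties
  open import Data.Nat.Induction using (<-rec)
  open import Data.Nat.Tactic.RingSolver using (solve-∀)
  open import Data.Bool using (true; false; if_then_else_)
  open import Data.Fin using (Fin; zero; suc; toℕ; fromℕ<)
  open import Data.Fin.Properties using (toℕ<n; toℕ-fromℕ<; toℕ-injective; any?)
  open import Data.Vec using (Vec; lookup)
  open import Data.Vec.Relation.Binary.Pointwise.Extensional using (ext; Pointwise-≡⇒≡)
  open import Data.Product as Product using (_×_; _,_; proj₁; proj₂; ∃; ∃₂)
  open import Data.Sum as Sum using (_⊎_; inj₁; inj₂)
  open import Function using (_∘_)
  open import Relation.Nullary using (¬_; Dec; yes; no; ¬?; contradiction)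
  open import Relation.Nullary.Reflects using (ofʸ; ofⁿ)
  open import Relation.Nullary.Decidable using (_×-dec_; _⊎-dec_)
  open import Relation.Unary using (Pred; Decidable)
  open import Relation.Binary.Definitions using (tri<; tri≈; tri>)
  open import Relation.Binary.PropositionalEquality

  SameUnorderedPair : {A : Set} → A → A → A → A → Set
  SameUnorderedPair u v x y = (u ≡ x × v ≡ y) ⊎ (u ≡ y × v ≡ x)

  𝟙[_≤_] : ℕ → ℕ → ℕ
  𝟙[ v ≤ t ] = if v ≤ᵇ t then 1 else 0

  𝟙-≤ : ∀ {v t} → v ≤ t → 𝟙[ v ≤ t ] ≡ 1
  𝟙-≤ {v} {t} v≤t with v ≤ᵇ t | ≤ᵇ-reflects-≤ v t
  ... | true  | _        = refl
  ... | false | ofⁿ v≰t = contradiction v≤t v≰t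

  𝟙-> : ∀ {v t} → t < v → 𝟙[ v ≤ t ] ≡ 0
  𝟙-> {v} {t} t<v with v ≤ᵇ t | ≤ᵇ-reflects-≤ v t
  ... | false | _        = refl
  ... | true  | ofʸ v≤t = contradiction v≤t (<⇒≱ t<v)

  𝟙-injective : ∀ {v y} → (∀ t → 𝟙[ v ≤ t ] ≡ 𝟙[ y ≤ t ]) → v ≡ y
  𝟙-injective same = ≤-antisym (≤-from same) (≤-from λ t → sym (same t))
    where
    ≤-from : ∀ {v y} → (∀ t → 𝟙[ v ≤ t ] ≡ 𝟙[ y ≤ t ]) → v ≤ y
    ≤-from {v} {y} same =
      ≮⇒≥ λ y<v → 0≢1+n (trans (sym (𝟙-> y<v)) (trans (same y) (𝟙-≤ (≤-refl {y}))))

  AgreeAt : ℕ → ℕ → ℕ → ℕ → ℕ → Set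
  AgreeAt u v x y t = 𝟙[ u ≤ t ] + 𝟙[ v ≤ t ] ≡ 𝟙[ x ≤ t ] + 𝟙[ y ≤ t ]

  Agree : ℕ → ℕ → ℕ → ℕ → Set
  Agree u v x y = ∀ t → AgreeAt u v x y t

  agree-least : ∀ {u v x y} → x ≤ y → Agree u v x y → x ≤ u
  agree-least {u} {v} {x} {y} x≤y agree = ≮⇒≥ λ u<x → 1+n≢0 (begin
    1 + 𝟙[ v ≤ u ]          ≡⟨ cong (_+ 𝟙[ v ≤ u ]) (𝟙-≤ (≤-refl {u})) ⟨
    𝟙[ u ≤ u ] + 𝟙[ v ≤ u ] ≡⟨ agree u ⟩
    𝟙[ x ≤ u ] + 𝟙[ y ≤ u ] ≡⟨ cong₂ _+_ (𝟙-> u<x) (𝟙-> (<-≤-trans u<x x≤y)) ⟩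
    0                        ∎)
    where open ≡-Reasoning

  agree-sorted : ∀ {u v x y} → u ≤ v → x ≤ y → Agree u v x y → u ≡ x × v ≡ y
  agree-sorted {u} {v} {x} {y} u≤v x≤y agree = u≡x , 𝟙-injective λ t →
    +-cancelˡ-≡ 𝟙[ x ≤ t ] 𝟙[ v ≤ t ] 𝟙[ y ≤ t ]
      (subst (λ z → 𝟙[ z ≤ t ] + 𝟙[ v ≤ t ] ≡ 𝟙[ x ≤ t ] + 𝟙[ y ≤ t ]) u≡x (agree t))
    where
    u≡x : u ≡ x
    u≡x = ≤-antisym (agree-least {v = y} u≤v λ t → sym (agree t)) (agree-least {v = v} x≤y agree)

  agree⇒SameUnorderedPair : ∀ {u v x y} → Agree u v x y → SameUnorderedPair u v x y
  agree⇒SameUnorderedPair {u} {v} {x} {y} agree with ≤-total u v | ≤-total x y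
  ... | inj₁ u≤v | inj₁ x≤y = inj₁ (agree-sorted u≤v x≤y agree)
  ... | inj₁ u≤v | inj₂ y≤x = inj₂ (agree-sorted u≤v y≤x λ t →
    trans (agree t) (+-comm 𝟙[ x ≤ t ] 𝟙[ y ≤ t ]))
  ... | inj₂ v≤u | inj₁ x≤y = inj₂ (Product.swap (agree-sorted v≤u x≤y λ t →
    trans (+-comm 𝟙[ v ≤ t ] 𝟙[ u ≤ t ]) (agree t)))
  ... | inj₂ v≤u | inj₂ y≤x = inj₁ (Product.swap (agree-sorted v≤u y≤x λ t →
    trans (+-comm 𝟙[ v ≤ t ] 𝟙[ u ≤ t ]) (trans (agree t) (+-comm 𝟙[ x ≤ t ] 𝟙[ y ≤ t ]))))

  InWindow : ℕ → ℕ → ℕ → Set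
  InWindow L m z = L ≤ z × z ≤ L + m

  agree-from-window : ∀ {L m u v x y} →
    InWindow L m u → InWindow L m v → InWindow L m x → InWindow L m y →
    (∀ (b : Fin m) → AgreeAt u v x y (L + toℕ b)) → Agree u v x y
  agree-from-window {L} {m} {u} {v} {x} {y} wu wv wx wy agree t with t <? L | L + m ≤? t
  ... | yes t<L | _ = trans (cong₂ _+_ (below wu) (below wv)) (sym (cong₂ _+_ (below wx) (below wy)))
    where
    below : ∀ {z} → InWindow L m z → 𝟙[ z ≤ t ] ≡ 0
    below (L≤z , _) = 𝟙-> (<-≤-trans t<L L≤z)
  ... | no _ | yes L+m≤t =
    trans (cong₂ _+_ (above wu) (above wv)) (sym (cong₂ _+_ (above wx) (above wy)))
    where
    above : ∀ {z} → InWindow L m z → 𝟙[ z ≤ t ] ≡ 1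
    above (_ , z≤L+m) = 𝟙-≤ (≤-trans z≤L+m L+m≤t)
  ... | no t≮L | no t≱L+m = subst (AgreeAt u v x y) L+b≡t (agree (fromℕ< b<m))
    where
    L≤t : L ≤ t
    L≤t = ≮⇒≥ t≮L
    b<m : t ∸ L < m
    b<m = subst (t ∸ L <_) (m+n∸m≡n L m) (∸-monoˡ-< (≰⇒> t≱L+m) L≤t)
    L+b≡t : L + toℕ (fromℕ< b<m) ≡ t
    L+b≡t = trans (cong (L +_) (toℕ-fromℕ< b<m)) (m+[n∸m]≡n L≤t)

  StrictlyIncreasing : ∀ {k} → (Fin k → ℕ) → Set
  StrictlyIncreasing f = ∀ a b → toℕ a < toℕ b → f a < f b

  increasing-tail : ∀ {k} {f : Fin (suc k) → ℕ} → StrictlyIncreasing f → StrictlyIncreasing (f ∘ suc)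
  increasing-tail inc a b a<b = inc (suc a) (suc b) (s≤s a<b)

  increasing-lower : ∀ {k m} {f : Fin k → ℕ} → StrictlyIncreasing f → (∀ a → m ≤ f a) →
                     ∀ a → m + toℕ a ≤ f a
  increasing-lower {m = m} {f} inc m≤f zero = subst (_≤ f zero) (sym (+-identityʳ m)) (m≤f zero)
  increasing-lower {m = m} {f} inc m≤f (suc a) = subst (_≤ f (suc a)) (sym (+-suc m (toℕ a)))
    (increasing-lower (increasing-tail inc) (λ b → ≤-<-trans (m≤f zero) (inc zero (suc b) z<s)) a)

  increasing-upper : ∀ {k M} {f : Fin k → ℕ} → StrictlyIncreasing f → (∀ a → f a ≤ M) →
                     ∀ a → f a + (k ∸ suc (toℕ a)) ≤ M
  increasing-upper {suc zero} {f = f} inc f≤M zero =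
    subst (_≤ _) (sym (+-identityʳ (f zero))) (f≤M zero)
  increasing-upper {suc (suc k)} {M} {f} inc f≤M zero = begin
    f zero + suc k    ≡⟨ +-suc (f zero) k ⟩
    suc (f zero) + k  ≤⟨ +-monoˡ-≤ k (inc zero (suc zero) z<s) ⟩
    f (suc zero) + k  ≤⟨ increasing-upper (increasing-tail inc) (f≤M ∘ suc) zero ⟩
    M                 ∎
    where open ≤-Reasoning
  increasing-upper {suc k} inc f≤M (suc a) = increasing-upper (increasing-tail inc) (f≤M ∘ suc) a

  InV-window : ∀ {k n V} → k ≤ n → InV k n V → ∀ a → InWindow (suc (toℕ a)) (n ∸ k) (lookup V a)
  InV-window {k} {n} {V} k≤n (range , inc) a = increasing-lower inc (proj₁ ∘ range) a , upper
    where
    s r : ℕ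
    s = suc (toℕ a)
    r = k ∸ s
    upper : lookup V a ≤ s + (n ∸ k)
    upper = +-cancelʳ-≤ r (lookup V a) (s + (n ∸ k)) (begin
      lookup V a + r     ≤⟨ increasing-upper inc (proj₂ ∘ range) a ⟩
      n                  ≡⟨ m∸n+n≡m k≤n ⟨
      (n ∸ k) + k        ≡⟨ cong ((n ∸ k) +_) (m+[n∸m]≡n (toℕ<n a)) ⟨
      (n ∸ k) + (s + r)  ≡⟨ +-assoc (n ∸ k) s r ⟨
      ((n ∸ k) + s) + r  ≡⟨ cong (_+ r) (+-comm (n ∸ k) s) ⟩
      (s + (n ∸ k)) + r  ∎)
      where open ≤-Reasoning

  SameColumns : ∀ {k} → Vec ℕ k → Vec ℕ k → Vec ℕ k → Vec ℕ k → Set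
  SameColumns {k} I J X Y =
    ∀ (a : Fin k) → SameUnorderedPair (lookup I a) (lookup J a) (lookup X a) (lookup Y a)

  χ-sum⇒SameColumns : ∀ {k n} (I J X Y : Vec ℕ k) → k ≤ n →
    InV k n I → InV k n J → InV k n X → InV k n Y →
    (∀ a b → χ n I a b + χ n J a b ≡ χ n X a b + χ n Y a b) → SameColumns I J X Y
  χ-sum⇒SameColumns {k} {n} I J X Y k≤n I∈ J∈ X∈ Y∈ χ-sum a = agree⇒SameUnorderedPair
    (agree-from-window (window {I} I∈) (window {J} J∈) (window {X} X∈) (window {Y} Y∈) (χ-sum a))
    where
    window : ∀ {V} → InV k n V → InWindow (suc (toℕ a)) (n ∸ k) (lookup V a)
    window {V} V∈ = InV-window {V = V} k≤n V∈ a

  ArcsCross-sym : ∀ {p p′ q q′} → ArcsCross p p′ q q′ → ArcsCross q q′ p p′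
  ArcsCross-sym = Sum.swap

  rearrangement : ∀ {p q p′ q′} → p < q → q′ < p′ → p * p′ + q * q′ < p * q′ + q * p′
  rearrangement {p} {q′ = q′} p<q q′<p′ with m≤n⇒∃[o]m+o≡n p<q | m≤n⇒∃[o]m+o≡n q′<p′
  ... | u , refl | v , refl = subst (lhs <_) (expand p q′ u v) (m≤m+n (suc lhs) (u + v + u * v))
    where
    lhs : ℕ
    lhs = p * (suc q′ + v) + (suc p + u) * q′
    expand : ∀ p q′ u v → suc (p * (suc q′ + v) + (suc p + u) * q′) + (u + v + u * v)
                          ≡ p * q′ + (suc p + u) * (suc q′ + v)
    expand = solve-∀

  rewire-noncrossing : ∀ {i i′ j j′} → i ≢ j → i′ ≢ j′ → i < i′ → j < j′ → i < j′ → j < i′ →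
    ¬ ArcsCross i i′ j j′ → i * i′ + j * j′ < i * j′ + j * i′ × ArcsCross i j′ j i′
  rewire-noncrossing {i} {i′} {j} {j′} i≢j i′≢j′ i<i′ j<j′ i<j′ j<i′ uncrossed
    with <-cmp i j | <-cmp i′ j′
  ... | tri≈ _ i≡j _ | _              = contradiction i≡j i≢j
  ... | _            | tri≈ _ i′≡j′ _ = contradiction i′≡j′ i′≢j′
  ... | tri< i<j _ _ | tri< i′<j′ _ _ = contradiction (inj₁ (i<j , j<i′ , i′<j′)) uncrossed
  ... | tri> _ _ j<i | tri> _ _ j′<i′ = contradiction (inj₂ (j<i , i<j′ , j′<i′)) uncrossed
  ... | tri< i<j _ _ | tri> _ _ j′<i′ = rearrangement i<j j′<i′ , inj₁ (i<j , j<j′ , j′<i′)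
  ... | tri> _ _ j<i | tri< i′<j′ _ _ =
    subst₂ _<_ (+-comm (j * j′) (i * i′)) (+-comm (j * i′) (i * j′)) (rearrangement j<i i′<j′) ,
    inj₂ (j<i , i<i′ , i′<j′)

  least-witness : ∀ {p} {P : Pred ℕ p} → Decidable P → ∀ {n} → P n →
                  ∃ λ m → P m × (∀ {e} → e < m → ¬ P e)
  least-witness {p} {P} P? {n} = <-rec (λ n → P n → Least) search n
    where
    Least : Set p
    Least = ∃ λ m → P m × (∀ {e} → e < m → ¬ P e)
    search : ∀ n → (∀ {m} → m < n → P m → Least) → P n → Least
    search n smaller Pn with anyUpTo? P? n
    ... | yes (m , m<n , Pm) = smaller m<n Pm
    ... | no none            = n , Pn , λ e<n Pe → none (_ , e<n , Pe)

  pairProduct : ∀ {k} → Vec ℕ k → Vec ℕ k → Fin k → Fin k → ℕ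
  pairProduct V W a b = lookup V a * lookup V b + lookup W a * lookup W b

  pairProduct-≤ : ∀ {k n} {V W : Vec ℕ k} → InV k n V → InV k n W →
                  ∀ a b → pairProduct V W a b ≤ n * n + n * n
  pairProduct-≤ (V-range , _) (W-range , _) a b =
    +-mono-≤ (*-mono-≤ (proj₂ (V-range a)) (proj₂ (V-range b)))
             (*-mono-≤ (proj₂ (W-range a)) (proj₂ (W-range b)))

  distance : ∀ {k} → Fin k → Fin k → ℕ
  distance a b = toℕ b ∸ toℕ a

  record DominantPair {k} (P Q : Fin k → Fin k → ℕ) : Set where
    field
      a₀ b₀  : Fin k
      a₀<b₀  : toℕ a₀ < toℕ b₀
      gap    : P a₀ b₀ < Q a₀ b₀
      nearer : ∀ a b → toℕ a < toℕ b → distance a b ≤ distance a₀ b₀ → P a b ≤ Q a b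

  module Columns {k} (I J X Y : Vec ℕ k) (same : SameColumns I J X Y) where

    i j x y : Fin k → ℕ
    i = lookup I
    j = lookup J
    x = lookup X
    y = lookup Y

    Straight Flipped Kept Swapped Tied : Fin k → Set
    Straight a = i a ≡ x a × j a ≡ y a
    Flipped  a = i a ≡ y a × j a ≡ x a
    Kept     a = Straight a × i a ≢ j a
    Swapped  a = Flipped a × i a ≢ j a
    Tied     a = Straight a × Flipped a

    TiedBetween : Fin k → Fin k → Set
    TiedBetween a b = ∀ l → toℕ a < toℕ l → toℕ l < toℕ b → i l ≡ j l

    classify : ∀ a → Tied a ⊎ Kept a ⊎ Swapped a
    classify a with i a ≟ j a | same a
    ... | no i≢j  | inj₁ s = inj₂ (inj₁ (s , i≢j))
    ... | no i≢j  | inj₂ f = inj₂ (inj₂ (f , i≢j))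
    ... | yes i≡j | inj₁ s@(i≡x , j≡y) = inj₁ (s , trans i≡j j≡y , trans (sym i≡j) i≡x)
    ... | yes i≡j | inj₂ f@(i≡y , j≡x) = inj₁ ((trans i≡j j≡x , trans (sym i≡j) i≡y) , f)

    kept? : ∀ a → Dec (Kept a)
    kept? a = ((i a ≟ x a) ×-dec (j a ≟ y a)) ×-dec ¬? (i a ≟ j a)

    swapped? : ∀ a → Dec (Swapped a)
    swapped? a = ((i a ≟ y a) ×-dec (j a ≟ x a)) ×-dec ¬? (i a ≟ j a)

    kept⇒¬swapped : ∀ {a} → Kept a → ¬ Swapped a
    kept⇒¬swapped ((i≡x , _) , i≢j) ((_ , j≡x) , _) = i≢j (trans i≡x (sym j≡x))

    straight-unless-swapped : ∀ a → ¬ Swapped a → Straight a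
    straight-unless-swapped a ¬swapped with classify a
    ... | inj₁ (s , _)        = s
    ... | inj₂ (inj₁ (s , _)) = s
    ... | inj₂ (inj₂ sw)      = contradiction sw ¬swapped

    flipped-unless-kept : ∀ a → ¬ Kept a → Flipped a
    flipped-unless-kept a ¬kept with classify a
    ... | inj₁ (_ , f)        = f
    ... | inj₂ (inj₁ kept)    = contradiction kept ¬kept
    ... | inj₂ (inj₂ (f , _)) = f

    tied⇒x≡y : ∀ {a} → i a ≡ j a → x a ≡ y a
    tied⇒x≡y {a} i≡j with same a
    ... | inj₁ (i≡x , j≡y) = trans (sym i≡x) (trans i≡j j≡y)
    ... | inj₂ (i≡y , j≡x) = trans (sym j≡x) (trans (sym i≡j) i≡y)

    Switch : Fin k → Fin k → Set
    Switch a b = toℕ a < toℕ b × (Kept a × Swapped b ⊎ Swapped a × Kept b)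

    switch? : ∀ a b → Dec (Switch a b)
    switch? a b =
      (toℕ a <? toℕ b) ×-dec ((kept? a ×-dec swapped? b) ⊎-dec (swapped? a ×-dec kept? b))

    aligned : ∀ {a b} → toℕ a < toℕ b → ¬ Switch a b → Straight a × Straight b ⊎ Flipped a × Flipped b
    aligned {a} {b} a<b ¬switch with classify a | classify b
    ... | inj₁ (sa , _)        | inj₁ (sb , _)        = inj₁ (sa , sb)
    ... | inj₁ (sa , _)        | inj₂ (inj₁ (sb , _)) = inj₁ (sa , sb)
    ... | inj₁ (_ , fa)        | inj₂ (inj₂ (fb , _)) = inj₂ (fa , fb)
    ... | inj₂ (inj₁ (sa , _)) | inj₁ (sb , _)        = inj₁ (sa , sb)
    ... | inj₂ (inj₁ (sa , _)) | inj₂ (inj₁ (sb , _)) = inj₁ (sa , sb)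
    ... | inj₂ (inj₁ ka)       | inj₂ (inj₂ sb)       = contradiction (a<b , inj₁ (ka , sb)) ¬switch
    ... | inj₂ (inj₂ (fa , _)) | inj₁ (_ , fb)        = inj₂ (fa , fb)
    ... | inj₂ (inj₂ sa)       | inj₂ (inj₁ kb)       = contradiction (a<b , inj₂ (sa , kb)) ¬switch
    ... | inj₂ (inj₂ (fa , _)) | inj₂ (inj₂ (fb , _)) = inj₂ (fa , fb)

    ¬switch⇒pairProduct≡ : ∀ {a b} → toℕ a < toℕ b → ¬ Switch a b →
                           pairProduct I J a b ≡ pairProduct X Y a b
    ¬switch⇒pairProduct≡ {a} {b} a<b ¬switch with aligned a<b ¬switch
    ... | inj₁ ((ia≡xa , ja≡ya) , (ib≡xb , jb≡yb)) =
      cong₂ _+_ (cong₂ _*_ ia≡xa ib≡xb) (cong₂ _*_ ja≡ya jb≡yb)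
    ... | inj₂ ((ia≡ya , ja≡xa) , (ib≡yb , jb≡xb)) =
      trans (cong₂ _+_ (cong₂ _*_ ia≡ya ib≡yb) (cong₂ _*_ ja≡xa jb≡xb)) (+-comm (y a * y b) (x a * x b))

    all-straight⇒≡ : (∀ a → Straight a) → I ≡ X × J ≡ Y
    all-straight⇒≡ straight =
      Pointwise-≡⇒≡ (ext (proj₁ ∘ straight)) , Pointwise-≡⇒≡ (ext (proj₂ ∘ straight))

    all-flipped⇒≡ : (∀ a → Flipped a) → I ≡ Y × J ≡ X
    all-flipped⇒≡ flipped =
      Pointwise-≡⇒≡ (ext (proj₁ ∘ flipped)) , Pointwise-≡⇒≡ (ext (proj₂ ∘ flipped))

    switch-exists : ¬ SameUnorderedPair I J X Y → ∃₂ Switch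
    switch-exists ≢ with any? kept? | any? swapped?
    ... | no ¬kept | _ =
      contradiction (inj₂ (all-flipped⇒≡ λ a → flipped-unless-kept a λ ka → ¬kept (a , ka))) ≢
    ... | _ | no ¬swapped =
      contradiction (inj₁ (all-straight⇒≡ λ a → straight-unless-swapped a λ sa → ¬swapped (a , sa))) ≢
    ... | yes (a , ka) | yes (b , sb) with <-cmp (toℕ a) (toℕ b)
    ...   | tri< a<b _ _ = a , b , a<b , inj₁ (ka , sb)
    ...   | tri≈ _ a≡b _ = contradiction (subst Swapped (sym (toℕ-injective a≡b)) sb) (kept⇒¬swapped ka)
    ...   | tri> _ _ b<a = b , a , b<a , inj₂ (sb , ka)

    SwitchAt : ℕ → Set
    SwitchAt e = ∃₂ λ a b → Switch a b × distance a b ≡ e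

    switchAt? : Decidable SwitchAt
    switchAt? e = any? λ a → any? λ b → switch? a b ×-dec (distance a b ≟ e)

    closest-switch : ¬ SameUnorderedPair I J X Y →
                     ∃₂ λ a₀ b₀ → Switch a₀ b₀ × (∀ a b → Switch a b → distance a₀ b₀ ≤ distance a b)
    closest-switch ≢ with switch-exists ≢
    ... | a , b , sw with least-witness switchAt? (a , b , sw , refl)
    ...   | _ , (a₀ , b₀ , sw₀ , refl) , none-closer =
      a₀ , b₀ , sw₀ , λ a b sw → ≮⇒≥ λ closer → none-closer closer (a , b , sw , refl)

    near-switch⇒TiedBetween : ∀ {d} → (∀ a b → Switch a b → d ≤ distance a b) →
                              ∀ {a b} → Switch a b → distance a b ≤ d → TiedBetween a b
    near-switch⇒TiedBetween {d} closest {a} {b} (a<b , kind) near l a<l l<b = tied (classify l) kind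
      where
      too-close : ∀ {a′ b′} → distance a′ b′ < distance a b → ¬ Switch a′ b′
      too-close closer sw = <⇒≱ (<-≤-trans closer near) (closest _ _ sw)
      al<ab : distance a l < distance a b
      al<ab = ∸-monoˡ-< l<b (<⇒≤ a<l)
      lb<ab : distance l b < distance a b
      lb<ab = ∸-monoʳ-< a<l (<⇒≤ l<b)
      tied : Tied l ⊎ Kept l ⊎ Swapped l → Kept a × Swapped b ⊎ Swapped a × Kept b → i l ≡ j l
      tied (inj₁ ((i≡x , _) , (_ , j≡x))) _ = trans i≡x (sym j≡x)
      tied (inj₂ (inj₁ kl)) (inj₁ (_ , sb)) = contradiction (l<b , inj₁ (kl , sb)) (too-close lb<ab)
      tied (inj₂ (inj₁ kl)) (inj₂ (sa , _)) = contradiction (a<l , inj₂ (sa , kl)) (too-close al<ab)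
      tied (inj₂ (inj₂ sl)) (inj₁ (ka , _)) = contradiction (a<l , inj₁ (ka , sl)) (too-close al<ab)
      tied (inj₂ (inj₂ sl)) (inj₂ (_ , kb)) = contradiction (l<b , inj₂ (sl , kb)) (too-close lb<ab)

    module _ (I↑ : StrictlyIncreasing i) (J↑ : StrictlyIncreasing j)
             (X↑ : StrictlyIncreasing x) (Y↑ : StrictlyIncreasing y) (nc : Noncrossing I J) where

      switch-rewires : ∀ {a b} → Switch a b → TiedBetween a b →
        pairProduct I J a b < pairProduct X Y a b × ArcsCross (x a) (x b) (y a) (y b)
      switch-rewires {a} {b} (a<b , kind) between = by-kind kind
        where
        rewired : ∀ {xa xb ya yb} → i a ≢ j a → i b ≢ j b →
                  i a ≡ xa → j a ≡ ya → i b ≡ yb → j b ≡ xb → xa < xb → ya < yb →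
                  pairProduct I J a b < xa * xb + ya * yb × ArcsCross xa xb ya yb
        rewired ia≢ja ib≢jb refl refl refl refl xa<xb ya<yb =
          rewire-noncrossing ia≢ja ib≢jb (I↑ a b a<b) (J↑ a b a<b) xa<xb ya<yb (nc a b a<b between)
        by-kind : Kept a × Swapped b ⊎ Swapped a × Kept b →
                  pairProduct I J a b < pairProduct X Y a b × ArcsCross (x a) (x b) (y a) (y b)
        by-kind (inj₁ (((ia≡xa , ja≡ya) , ia≢ja) , ((ib≡yb , jb≡xb) , ib≢jb))) =
          rewired ia≢ja ib≢jb ia≡xa ja≡ya ib≡yb jb≡xb (X↑ a b a<b) (Y↑ a b a<b)
        by-kind (inj₂ (((ia≡ya , ja≡xa) , ia≢ja) , ((ib≡xb , jb≡yb) , ib≢jb))) =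
          Product.map (subst (pairProduct I J a b <_) (+-comm (y a * y b) (x a * x b))) ArcsCross-sym
            (rewired ia≢ja ib≢jb ia≡ya ja≡xa ib≡xb jb≡yb (Y↑ a b a<b) (X↑ a b a<b))

      dominant-switch : ¬ SameUnorderedPair I J X Y →
                        DominantPair (pairProduct I J) (pairProduct X Y) × Crossing X Y
      dominant-switch ≢ with closest-switch ≢
      ... | a₀ , b₀ , sw₀@(a₀<b₀ , _) , closest = dominant , crossing
        where
        tied : ∀ {a b} → Switch a b → distance a b ≤ distance a₀ b₀ → TiedBetween a b
        tied = near-switch⇒TiedBetween closest
        rewires₀ : pairProduct I J a₀ b₀ < pairProduct X Y a₀ b₀ × ArcsCross (x a₀) (x b₀) (y a₀) (y b₀)
        rewires₀ = switch-rewires sw₀ (tied sw₀ ≤-refl)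
        nearer : ∀ a b → toℕ a < toℕ b → distance a b ≤ distance a₀ b₀ →
                 pairProduct I J a b ≤ pairProduct X Y a b
        nearer a b a<b near with switch? a b
        ... | yes sw     = <⇒≤ (proj₁ (switch-rewires sw (tied sw near)))
        ... | no ¬switch = ≤-reflexive (¬switch⇒pairProduct≡ a<b ¬switch)
        dominant : DominantPair (pairProduct I J) (pairProduct X Y)
        dominant = record { a₀ = a₀ ; b₀ = b₀ ; a₀<b₀ = a₀<b₀ ; gap = proj₁ rewires₀ ; nearer = nearer }
        crossing : Crossing X Y
        crossing nc-XY =
          nc-XY a₀ b₀ a₀<b₀ (λ l a₀<l l<b₀ → tied⇒x≡y (tied sw₀ ≤-refl l a₀<l l<b₀)) (proj₂ rewires₀)

module Weights where
  open Combinatorics using (pairProduct; distance; DominantPair)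
  open import Data.Nat.Base as ℕ using (ℕ; zero; suc; _∸_)
  import Data.Nat.Properties as ℕ
  import Data.Nat.Coprimality as Coprime
  import Data.Integer.Base as ℤ
  import Data.Integer.Properties as ℤ
  open import Data.Bool using (true; false; if_then_else_)
  open import Data.Fin using (Fin; toℕ; zero; suc)
  open import Data.Fin.Properties using (toℕ<n)
  open import Data.Vec using (Vec; lookup)
  open import Data.Sum using (inj₁; inj₂)
  open import Data.Rational.Base
    using (ℚ; mkℚ; 0ℚ; 1ℚ; _+_; _*_; _≤_; _<_; 1/_; *≤*; *<*; >-nonZero; positive; nonNegative)
  open import Data.Rational.Properties
  open import Algebra.Properties.CommutativeMonoid.Sum +-0-commutativeMonoid
    using (sum; sum-syntax; ∑-distrib-+; sum-cong-≗)
  open import Algebra.Bundles using (module CommutativeMonoid)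
  open import Algebra.Properties.CommutativeSemigroup
    (CommutativeMonoid.commutativeSemigroup +-0-commutativeMonoid) using (xy∙z≈xz∙y)
  open import Function using (_∘_)
  open import Relation.Nullary using (¬_; Dec; yes; no; contradiction)
  open import Relation.Nullary.Reflects using (ofʸ; ofⁿ)
  open import Relation.Binary.PropositionalEquality

  toℚ≡mkℚ : ∀ m → toℚ m ≡ mkℚ (ℤ.+ m) 0 (Coprime.sym (Coprime.1-coprimeTo m))
  toℚ≡mkℚ m = normalize-coprime (Coprime.sym (Coprime.1-coprimeTo m))

  -- On representatives with denominator 1, ℚ's _+_ and _*_ compute to the integer operations.
  toℚ-+ : ∀ m n → toℚ (m ℕ.+ n) ≡ toℚ m + toℚ n
  toℚ-+ m n = sym (trans (cong₂ _+_ (toℚ≡mkℚ m) (toℚ≡mkℚ n))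
    (cong (ℚ._/ 1) (cong₂ ℤ._+_ (ℤ.*-identityʳ (ℤ.+ m)) (ℤ.*-identityʳ (ℤ.+ n)))))

  toℚ-* : ∀ m n → toℚ (m ℕ.* n) ≡ toℚ m * toℚ n
  toℚ-* m n = sym (trans (cong₂ _*_ (toℚ≡mkℚ m) (toℚ≡mkℚ n)) (cong (ℚ._/ 1) (ℤ.+◃n≡+n (m ℕ.* n))))

  toℚ-mono-≤ : ∀ {m n} → m ℕ.≤ n → toℚ m ≤ toℚ n
  toℚ-mono-≤ {m} {n} m≤n rewrite toℚ≡mkℚ m | toℚ≡mkℚ n =
    *≤* (subst₂ ℤ._≤_ (sym (ℤ.*-identityʳ (ℤ.+ m))) (sym (ℤ.*-identityʳ (ℤ.+ n))) (ℤ.+≤+ m≤n))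

  toℚ-mono-< : ∀ {m n} → m ℕ.< n → toℚ m < toℚ n
  toℚ-mono-< {m} {n} m<n rewrite toℚ≡mkℚ m | toℚ≡mkℚ n =
    *<* (subst₂ ℤ._<_ (sym (ℤ.*-identityʳ (ℤ.+ m))) (sym (ℤ.*-identityʳ (ℤ.+ n))) (ℤ.+<+ m<n))

  toℚ-nonNeg : ∀ m → 0ℚ ≤ toℚ m
  toℚ-nonNeg m = toℚ-mono-≤ {0} {m} ℕ.z≤n

  toℚ[1+n]>0 : ∀ n → 0ℚ < toℚ (suc n)
  toℚ[1+n]>0 n = toℚ-mono-< {0} {suc n} ℕ.z<s

  *-nonNeg : ∀ {p q} → 0ℚ ≤ p → 0ℚ ≤ q → 0ℚ ≤ p * q
  *-nonNeg {p} {q} p≥0 q≥0 =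
    nonNegative⁻¹ (p * q) {{nonNeg*nonNeg⇒nonNeg p {{nonNegative p≥0}} q {{nonNegative q≥0}}}}

  +-cancel-slack : ∀ {a b p m} → a + p ≤ b + m → m < p → a < b
  +-cancel-slack {a} {b} {p} {m} a+p≤b+m m<p = ≰⇒> λ b≤a → <-irrefl refl (begin-strict
    b + p  ≤⟨ +-monoˡ-≤ p b≤a ⟩
    a + p  ≤⟨ a+p≤b+m ⟩
    b + m  <⟨ +-monoʳ-< b m<p ⟩
    b + p  ∎)
    where open ≤-Reasoning

  1/[1+_] : ℕ → ℚ
  1/[1+ n ] = (1/ toℚ (suc n)) {{>-nonZero (toℚ[1+n]>0 n)}}

  [1+n]*1/[1+n]≡1 : ∀ n → toℚ (suc n) * 1/[1+ n ] ≡ 1ℚ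
  [1+n]*1/[1+n]≡1 n = *-inverseʳ (toℚ (suc n)) {{>-nonZero (toℚ[1+n]>0 n)}}

  1/[1+n]>0 : ∀ n → 0ℚ < 1/[1+ n ]
  1/[1+n]>0 n = positive⁻¹ 1/[1+ n ] {{1/pos⇒pos (toℚ (suc n)) {{positive (toℚ[1+n]>0 n)}}}}

  1/[1+n]≤1 : ∀ n → 1/[1+ n ] ≤ 1ℚ
  1/[1+n]≤1 n = begin
    1/[1+ n ]               ≡⟨ *-identityˡ 1/[1+ n ] ⟨
    1ℚ * 1/[1+ n ]          ≤⟨ *-monoʳ-≤-nonNeg 1/[1+ n ] {{nonNegative (<⇒≤ (1/[1+n]>0 n))}}
                                 (toℚ-mono-≤ {1} {suc n} (ℕ.s≤s ℕ.z≤n)) ⟩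
    toℚ (suc n) * 1/[1+ n ] ≡⟨ [1+n]*1/[1+n]≡1 n ⟩
    1ℚ                      ∎
    where open ≤-Reasoning

  n*1/[1+n]<1 : ∀ n → toℚ n * 1/[1+ n ] < 1ℚ
  n*1/[1+n]<1 n = begin-strict
    toℚ n * 1/[1+ n ]       <⟨ *-monoˡ-<-pos 1/[1+ n ] {{positive (1/[1+n]>0 n)}}
                                 (toℚ-mono-< (ℕ.n<1+n n)) ⟩
    toℚ (suc n) * 1/[1+ n ] ≡⟨ [1+n]*1/[1+n]≡1 n ⟩
    1ℚ                      ∎
    where open ≤-Reasoning

  sumFin≡sum : ∀ n (f : Fin n → ℚ) → sumFin n f ≡ sum f
  sumFin≡sum zero    f = refl
  sumFin≡sum (suc n) f = cong (f zero +_) (sumFin≡sum n (f ∘ suc))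

  sum-const : ∀ n c → ∑[ _ < n ] c ≡ toℚ n * c
  sum-const zero    c = sym (*-zeroˡ c)
  sum-const (suc n) c = begin
    c + ∑[ _ < n ] c    ≡⟨ cong (c +_) (sum-const n c) ⟩
    c + toℚ n * c      ≡⟨ cong (_+ toℚ n * c) (*-identityˡ c) ⟨
    1ℚ * c + toℚ n * c ≡⟨ *-distribʳ-+ c 1ℚ (toℚ n) ⟨
    (1ℚ + toℚ n) * c   ≡⟨ cong (_* c) (toℚ-+ 1 n) ⟨
    toℚ (suc n) * c    ∎
    where open ≡-Reasoning

  sum-+-const : ∀ {n} (f : Fin n → ℚ) c → ∑[ i < n ] (f i + c) ≡ sum f + toℚ n * c
  sum-+-const {n} f c = trans (∑-distrib-+ f (λ _ → c)) (cong (sum f +_) (sum-const n c))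

  sum-mono-≤ : ∀ {n} {f g : Fin n → ℚ} → (∀ i → f i ≤ g i) → sum f ≤ sum g
  sum-mono-≤ {zero}  f≤g = ≤-refl
  sum-mono-≤ {suc n} f≤g = +-mono-≤ (f≤g zero) (sum-mono-≤ (f≤g ∘ suc))

  sum-mono-≤-gap : ∀ {n} {f g : Fin n → ℚ} {p} i₀ → (∀ i → f i ≤ g i) → f i₀ + p ≤ g i₀ →
                   sum f + p ≤ sum g
  sum-mono-≤-gap {f = f} {g} {p} zero f≤g gap = begin
    (f zero + sum (f ∘ suc)) + p ≡⟨ xy∙z≈xz∙y (f zero) (sum (f ∘ suc)) p ⟩
    (f zero + p) + sum (f ∘ suc) ≤⟨ +-mono-≤ gap (sum-mono-≤ (f≤g ∘ suc)) ⟩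
    g zero + sum (g ∘ suc)       ∎
    where open ≤-Reasoning
  sum-mono-≤-gap {f = f} {g} {p} (suc i₀) f≤g gap = begin
    (f zero + sum (f ∘ suc)) + p ≡⟨ +-assoc (f zero) (sum (f ∘ suc)) p ⟩
    f zero + (sum (f ∘ suc) + p) ≤⟨ +-mono-≤ (f≤g zero) (sum-mono-≤-gap i₀ (f≤g ∘ suc) gap) ⟩
    g zero + sum (g ∘ suc)       ∎
    where open ≤-Reasoning

  weightTerm : ∀ {k} → (ℕ → ℚ) → (Fin k → Fin k → ℕ) → Fin k → Fin k → ℚ
  weightTerm α P a b = if toℕ a ℕ.<ᵇ toℕ b then α (distance a b) * toℚ (P a b) else 0ℚ

  pairWeight : ∀ {k} → (ℕ → ℚ) → (Fin k → Fin k → ℕ) → ℚ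
  pairWeight {k} α P = ∑[ a < k ] ∑[ b < k ] weightTerm α P a b

  weightTerm-< : ∀ {k} α P {a b : Fin k} → toℕ a ℕ.< toℕ b →
                 weightTerm α P a b ≡ α (distance a b) * toℚ (P a b)
  weightTerm-< α P {a} {b} a<b with toℕ a ℕ.<ᵇ toℕ b | ℕ.<ᵇ-reflects-< (toℕ a) (toℕ b)
  ... | true  | _        = refl
  ... | false | ofⁿ a≮b = contradiction a<b a≮b

  weightTerm-≮ : ∀ {k} α P {a b : Fin k} → ¬ toℕ a ℕ.< toℕ b → weightTerm α P a b ≡ 0ℚ
  weightTerm-≮ α P {a} {b} a≮b with toℕ a ℕ.<ᵇ toℕ b | ℕ.<ᵇ-reflects-< (toℕ a) (toℕ b)
  ... | false | _        = refl
  ... | true  | ofʸ a<b = contradiction a<b a≮b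

  w-+ : ∀ {k} α (V W : Vec ℕ k) → w α V + w α W ≡ pairWeight α (pairProduct V W)
  w-+ {k} α V W = begin
    w α V + w α W
      ≡⟨ cong₂ _+_ (double-sum (term V)) (double-sum (term W)) ⟩
    ∑[ a < k ] sum (term V a) + ∑[ a < k ] sum (term W a)
      ≡⟨ ∑-distrib-+ (λ a → sum (term V a)) (λ a → sum (term W a)) ⟨
    ∑[ a < k ] (sum (term V a) + sum (term W a))
      ≡⟨ sum-cong-≗ (λ a → ∑-distrib-+ (term V a) (term W a)) ⟨
    ∑[ a < k ] ∑[ b < k ] (term V a b + term W a b)
      ≡⟨ sum-cong-≗ (λ a → sum-cong-≗ (term-+ a)) ⟩
    pairWeight α (pairProduct V W)
      ∎
    where
    open ≡-Reasoning
    term : Vec ℕ k → Fin k → Fin k → ℚ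
    term V a b = if toℕ a ℕ.<ᵇ toℕ b
                 then α (toℕ b ∸ toℕ a) * toℚ (lookup V a) * toℚ (lookup V b)
                 else 0ℚ
    double-sum : (f : Fin k → Fin k → ℚ) → sumFin k (λ a → sumFin k (f a)) ≡ ∑[ a < k ] sum (f a)
    double-sum f = trans (sumFin≡sum k _) (sum-cong-≗ (λ a → sumFin≡sum k (f a)))
    term-+ : ∀ a b → term V a b + term W a b ≡ weightTerm α (pairProduct V W) a b
    term-+ a b with toℕ a ℕ.<ᵇ toℕ b
    ... | false = +-identityʳ 0ℚ
    ... | true  = begin
      αₑ * toℚ va * toℚ vb + αₑ * toℚ wa * toℚ wb
        ≡⟨ cong₂ _+_ (*-assoc αₑ (toℚ va) (toℚ vb)) (*-assoc αₑ (toℚ wa) (toℚ wb)) ⟩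
      αₑ * (toℚ va * toℚ vb) + αₑ * (toℚ wa * toℚ wb)
        ≡⟨ *-distribˡ-+ αₑ (toℚ va * toℚ vb) (toℚ wa * toℚ wb) ⟨
      αₑ * (toℚ va * toℚ vb + toℚ wa * toℚ wb)
        ≡⟨ cong (αₑ *_) (cong₂ _+_ (toℚ-* va vb) (toℚ-* wa wb)) ⟨
      αₑ * (toℚ (va ℕ.* vb) + toℚ (wa ℕ.* wb))
        ≡⟨ cong (αₑ *_) (toℚ-+ (va ℕ.* vb) (wa ℕ.* wb)) ⟨
      αₑ * toℚ (va ℕ.* vb ℕ.+ wa ℕ.* wb)
        ∎
      where
      αₑ : ℚ
      αₑ = α (distance a b)
      va vb wa wb : ℕ
      va = lookup V a
      vb = lookup V b
      wa = lookup W a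
      wb = lookup W b

  PositiveOn : ℕ → (ℕ → ℚ) → Set
  PositiveOn N α = ∀ i → 1 ℕ.≤ i → i ℕ.≤ N → 0ℚ < α i

  Decaying : ℚ → ℕ → (ℕ → ℚ) → Set
  Decaying ε N α = ∀ i → 1 ℕ.≤ i → suc i ℕ.≤ N → α (suc i) < ε * α i

  module _ {ε N α} (ε≤1 : ε ≤ 1ℚ) (α>0 : PositiveOn N α) (decay : Decaying ε N α) where

    decaying-antitone : ∀ {d} e → 1 ℕ.≤ d → d ℕ.≤ e → e ℕ.≤ N → α e ≤ α d
    decaying-antitone {d} e 1≤d d≤e e≤N with ℕ.m≤n⇒m<n∨m≡n d≤e
    ... | inj₂ refl = ≤-refl
    ... | inj₁ (ℕ.s≤s {n = e′} d≤e′) = begin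
      α (suc e′)  ≤⟨ <⇒≤ (decay e′ 1≤e′ e≤N) ⟩
      ε * α e′    ≤⟨ *-monoʳ-≤-nonNeg (α e′) {{nonNegative (<⇒≤ (α>0 e′ 1≤e′ e′≤N))}} ε≤1 ⟩
      1ℚ * α e′   ≡⟨ *-identityˡ (α e′) ⟩
      α e′        ≤⟨ decaying-antitone e′ 1≤d d≤e′ e′≤N ⟩
      α d         ∎
      where
      open ≤-Reasoning
      1≤e′ : 1 ℕ.≤ e′
      1≤e′ = ℕ.≤-trans 1≤d d≤e′
      e′≤N : e′ ℕ.≤ N
      e′≤N = ℕ.≤-trans (ℕ.n≤1+n e′) e≤N

    decaying-far : 0ℚ ≤ ε → ∀ {d e} → 1 ℕ.≤ d → d ℕ.< e → e ℕ.≤ N → α e ≤ ε * α d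
    decaying-far ε≥0 {d} {suc e} 1≤d (ℕ.s≤s d≤e) e+1≤N = begin
      α (suc e)  ≤⟨ <⇒≤ (decay e (ℕ.≤-trans 1≤d d≤e) e+1≤N) ⟩
      ε * α e    ≤⟨ *-monoˡ-≤-nonNeg ε {{nonNegative ε≥0}}
                      (decaying-antitone e 1≤d d≤e (ℕ.≤-trans (ℕ.n≤1+n e) e+1≤N)) ⟩
      ε * α d    ∎
      where open ≤-Reasoning

  module _ {k K : ℕ} {α : ℕ → ℚ}
           (α>0 : PositiveOn (k ∸ 1) α) (decay : Decaying 1/[1+ k ℕ.* k ℕ.* K ] (k ∸ 1) α)
           {P Q : Fin k → Fin k → ℕ} (P≤K : ∀ a b → P a b ℕ.≤ K) (dom : DominantPair P Q) where

    open DominantPair dom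

    private
      ε : ℚ
      ε = 1/[1+ k ℕ.* k ℕ.* K ]

      ε≥0 : 0ℚ ≤ ε
      ε≥0 = <⇒≤ (1/[1+n]>0 (k ℕ.* k ℕ.* K))

      d : ℕ
      d = distance a₀ b₀

      1≤d : 1 ℕ.≤ d
      1≤d = ℕ.m<n⇒0<n∸m a₀<b₀

      distance≤k∸1 : ∀ (a b : Fin k) → distance a b ℕ.≤ k ∸ 1
      distance≤k∸1 a b = ℕ.≤-trans (ℕ.m∸n≤m (toℕ b) (toℕ a)) (ℕ.∸-monoˡ-≤ 1 (toℕ<n b))

      αd>0 : 0ℚ < α d
      αd>0 = α>0 d 1≤d (distance≤k∸1 a₀ b₀)

      α-nonNeg : ∀ {a b : Fin k} → toℕ a ℕ.< toℕ b → 0ℚ ≤ α (distance a b)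
      α-nonNeg {a} {b} a<b = <⇒≤ (α>0 _ (ℕ.m<n⇒0<n∸m a<b) (distance≤k∸1 a b))

      c : ℚ
      c = toℚ K * (ε * α d)

      c≥0 : 0ℚ ≤ c
      c≥0 = *-nonNeg (toℚ-nonNeg K) (*-nonNeg ε≥0 (<⇒≤ αd>0))

      ≤-+c : ∀ {p q} → p ≤ q → p ≤ q + c
      ≤-+c {p} {q} p≤q = begin
        p       ≤⟨ p≤q ⟩
        q       ≡⟨ +-identityʳ q ⟨
        q + 0ℚ  ≤⟨ +-monoʳ-≤ q c≥0 ⟩
        q + c   ∎
        where open ≤-Reasoning

      c≤+c : ∀ {q} → 0ℚ ≤ q → c ≤ q + c
      c≤+c {q} q≥0 = begin
        c       ≡⟨ +-identityˡ c ⟨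
        0ℚ + c  ≤⟨ +-monoˡ-≤ c q≥0 ⟩
        q + c   ∎
        where open ≤-Reasoning

      near-bound : ∀ {a b} → toℕ a ℕ.< toℕ b → distance a b ℕ.≤ d →
                   α (distance a b) * toℚ (P a b) ≤ α (distance a b) * toℚ (Q a b)
      near-bound {a} {b} a<b near = *-monoˡ-≤-nonNeg (α (distance a b)) {{nonNegative (α-nonNeg a<b)}}
                                      (toℚ-mono-≤ (nearer a b a<b near))

      far-bound : ∀ {a b} → toℕ a ℕ.< toℕ b → d ℕ.< distance a b → α (distance a b) * toℚ (P a b) ≤ c
      far-bound {a} {b} a<b far = begin
        αₑ * toℚ (P a b)  ≤⟨ *-monoˡ-≤-nonNeg αₑ {{nonNegative (α-nonNeg a<b)}} (toℚ-mono-≤ (P≤K a b)) ⟩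
        αₑ * toℚ K        ≡⟨ *-comm αₑ (toℚ K) ⟩
        toℚ K * αₑ        ≤⟨ *-monoˡ-≤-nonNeg (toℚ K) {{nonNegative (toℚ-nonNeg K)}}
                               (decaying-far (1/[1+n]≤1 (k ℕ.* k ℕ.* K)) α>0 decay ε≥0
                                 1≤d far (distance≤k∸1 a b)) ⟩
        c                 ∎
        where
        open ≤-Reasoning
        αₑ : ℚ
        αₑ = α (distance a b)

      pair-bound : ∀ {a b} → toℕ a ℕ.< toℕ b → Dec (distance a b ℕ.≤ d) →
                   α (distance a b) * toℚ (P a b) ≤ α (distance a b) * toℚ (Q a b) + c
      pair-bound a<b (yes near) = ≤-+c (near-bound a<b near)
      pair-bound {a} {b} a<b (no far) =
        ≤-trans (far-bound a<b (ℕ.≰⇒> far)) (c≤+c (*-nonNeg (α-nonNeg a<b) (toℚ-nonNeg (Q a b))))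

      term-bound : ∀ a b → Dec (toℕ a ℕ.< toℕ b) → weightTerm α P a b ≤ weightTerm α Q a b + c
      term-bound a b (yes a<b) = begin
        weightTerm α P a b                  ≡⟨ weightTerm-< α P a<b ⟩
        α (distance a b) * toℚ (P a b)      ≤⟨ pair-bound a<b (distance a b ℕ.≤? d) ⟩
        α (distance a b) * toℚ (Q a b) + c  ≡⟨ cong (_+ c) (weightTerm-< α Q a<b) ⟨
        weightTerm α Q a b + c              ∎
        where open ≤-Reasoning
      term-bound a b (no a≮b) = begin
        weightTerm α P a b      ≡⟨ weightTerm-≮ α P a≮b ⟩
        0ℚ                      ≤⟨ ≤-+c ≤-refl ⟩
        0ℚ + c                  ≡⟨ cong (_+ c) (weightTerm-≮ α Q a≮b) ⟨
        weightTerm α Q a b + c  ∎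
        where open ≤-Reasoning

      term-gap : weightTerm α P a₀ b₀ + α d ≤ weightTerm α Q a₀ b₀ + c
      term-gap = ≤-+c (begin
        weightTerm α P a₀ b₀ + α d  ≡⟨ cong (_+ α d) (weightTerm-< α P a₀<b₀) ⟩
        α d * toℚ p + α d           ≡⟨ +-comm (α d * toℚ p) (α d) ⟩
        α d + α d * toℚ p           ≡⟨ cong (_+ α d * toℚ p) (*-identityʳ (α d)) ⟨
        α d * 1ℚ + α d * toℚ p      ≡⟨ *-distribˡ-+ (α d) 1ℚ (toℚ p) ⟨
        α d * (1ℚ + toℚ p)          ≡⟨ cong (α d *_) (toℚ-+ 1 p) ⟨
        α d * toℚ (suc p)           ≤⟨ *-monoˡ-≤-nonNeg (α d) {{nonNegative (α-nonNeg a₀<b₀)}}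
                                         (toℚ-mono-≤ gap) ⟩
        α d * toℚ (Q a₀ b₀)         ≡⟨ weightTerm-< α Q a₀<b₀ ⟨
        weightTerm α Q a₀ b₀        ∎)
        where
        open ≤-Reasoning
        p : ℕ
        p = P a₀ b₀

      pairWeight-gap : pairWeight α P + α d ≤ pairWeight α Q + toℚ k * (toℚ k * c)
      pairWeight-gap = begin
        pairWeight α P + α d
          ≤⟨ sum-mono-≤-gap a₀ (λ a → sum-mono-≤ (bound a)) (sum-mono-≤-gap b₀ (bound a₀) term-gap) ⟩
        ∑[ a < k ] ∑[ b < k ] (weightTerm α Q a b + c)
          ≡⟨ sum-cong-≗ (λ a → sum-+-const (weightTerm α Q a) c) ⟩
        ∑[ a < k ] (∑[ b < k ] weightTerm α Q a b + toℚ k * c)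
          ≡⟨ sum-+-const (λ a → ∑[ b < k ] weightTerm α Q a b) (toℚ k * c) ⟩
        pairWeight α Q + toℚ k * (toℚ k * c)
          ∎
        where
        open ≤-Reasoning
        bound : ∀ a b → weightTerm α P a b ≤ weightTerm α Q a b + c
        bound a b = term-bound a b (toℕ a ℕ.<? toℕ b)

      slack<α : toℚ k * (toℚ k * c) < α d
      slack<α = begin-strict
        toℚ k * (toℚ k * (toℚ K * (ε * α d))) ≡⟨ *-assoc (toℚ k) (toℚ k) _ ⟨
        toℚ k * toℚ k * (toℚ K * (ε * α d))   ≡⟨ *-assoc (toℚ k * toℚ k) (toℚ K) _ ⟨
        toℚ k * toℚ k * toℚ K * (ε * α d)     ≡⟨ cong (_* (ε * α d)) toℚ-k*k*K ⟨
        toℚ (k ℕ.* k ℕ.* K) * (ε * α d)       ≡⟨ *-assoc (toℚ (k ℕ.* k ℕ.* K)) ε (α d) ⟨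
        toℚ (k ℕ.* k ℕ.* K) * ε * α d         <⟨ *-monoˡ-<-pos (α d) {{positive αd>0}}
                                                     (n*1/[1+n]<1 (k ℕ.* k ℕ.* K)) ⟩
        1ℚ * α d                              ≡⟨ *-identityˡ (α d) ⟩
        α d                                   ∎
        where
        open ≤-Reasoning
        toℚ-k*k*K : toℚ (k ℕ.* k ℕ.* K) ≡ toℚ k * toℚ k * toℚ K
        toℚ-k*k*K = trans (toℚ-* (k ℕ.* k) K) (cong (_* toℚ K) (toℚ-* k k))

    dominantPair⇒pairWeight-< : pairWeight α P < pairWeight α Q
    dominantPair⇒pairWeight-< = +-cancel-slack pairWeight-gap slack<α

open Combinatorics
open Weights

lemma4p5 : (k n : ℕ) → 1 ℕ.≤ k → k ℕ.< n →
    ∃ λ (ε : ℚ) → 0ℚ ℚ.< ε ×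
      ((α : ℕ → ℚ) →
       (∀ i → 1 ℕ.≤ i → i ℕ.≤ k ∸ 1 → 0ℚ ℚ.< α i) →
       (∀ i → 1 ℕ.≤ i → suc i ℕ.≤ k ∸ 1 → α (suc i) ℚ.< ε ℚ.* α i) →
       (I J X Y : Vec ℕ k) →
       InV k n I → InV k n J → InV k n X → InV k n Y →
       ¬ ((I ≡ X × J ≡ Y) ⊎ (I ≡ Y × J ≡ X)) →
       Noncrossing I J →
       (∀ (a : Fin k) (b : Fin (n ∸ k)) → χ n I a b ℕ.+ χ n J a b ≡ χ n X a b ℕ.+ χ n Y a b) →
       Crossing X Y × w α I ℚ.+ w α J ℚ.< w α X ℚ.+ w α Y)
lemma4p5 k n _ k<n = 1/[1+ k ℕ.* k ℕ.* K ] , 1/[1+n]>0 (k ℕ.* k ℕ.* K) ,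
  λ α α>0 decay I J X Y I∈ J∈ X∈ Y∈ ≢ nc χ-sum →
    let same                = χ-sum⇒SameColumns I J X Y (ℕ.<⇒≤ k<n) I∈ J∈ X∈ Y∈ χ-sum
        dominant , crossing = Columns.dominant-switch I J X Y same
                                (proj₂ I∈) (proj₂ J∈) (proj₂ X∈) (proj₂ Y∈) nc ≢
        weight-<            = dominantPair⇒pairWeight-< α>0 decay
                                (pairProduct-≤ {V = I} {W = J} I∈ J∈) dominant
    in crossing , subst₂ ℚ._<_ (sym (w-+ α I J)) (sym (w-+ α X Y)) weight-<
  where
  K : ℕ
  K = n ℕ.* n ℕ.+ n ℕ.* n
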